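{- For every finite subset $S$ of $\mathbb{Z}$ there exists a constant $C$ (depending only on $S$) such that every infinite word $\omega = x_1x_2x_3\cdots$ with all $x_i \in S$ contains arbitrarily long factors $UV$ (i.e., for every $N$ there is such a factor with $|U| \ge N$) such that $|U| = |V|$ and $\left|\sum U - \sum V\right| \le C$.
   Context: A factor of $\omega = x_1x_2x_3\cdots$ is a finite block $x_ix_{i+1}\cdots x_{i+n}$ of consecutive letters; a factor $UV$ means the concatenation of two consecutive factors $U$ and $V$. For a factor $B = x_i x_{i+1}\cdots x_{i+n}$, $|B| = n+1$ denotes its length and $\sum B = x_i + x_{i+1} + \cdots + x_{i+n}$ the sum of its letters. -}

module Defs where

open import Data.Nat using (ℕ; zero; suc; _+_)
open import Data.Integer using (ℤ; 0ℤ) renaming (_+_ to _+ℤ_)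

-- An infinite word ω = x₁x₂x₃⋯ is modelled as a function ℕ → ℤ
-- (0-indexed: ω 0 = x₁).

blockSum : (ℕ → ℤ) → ℕ → ℕ → ℤ
blockSum ω i zero    = 0ℤ
blockSum ω i (suc n) = ω i +ℤ blockSum ω (suc i) n

module Submission where

-- Let M bound the absolute values of the letters of ω and fix a
-- window length n.  The balance  g(i) = Σ ω[i, i+n) − Σ ω[i+n, i+2n)  changes
-- by at most 4M when i moves one step to the right, since only four letters
-- enter or leave the two windows.  A sequence whose steps are at most 2D
-- cannot jump across the interval [−D, D]: as long as it avoids that
-- interval it keeps its sign.  With D = 2M we conclude that either some
-- balance satisfies |g(i)| ≤ 2M (the factor UV we want), or, on a long initial
-- range, g is everywhere positive or everywhere negative.  In the positive case
-- the window sums  Σ ω[kn, kn+n)  strictly decrease in k, so after 2nM + 1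
-- steps they have fallen by more than 2nM, contradicting |Σ ω[x, x+n)| ≤ nM;
-- the negative case is the same argument for −ω.  Hence C = 2M works, where
-- M is the sum of the absolute values of the elements of S.

open import Defs
open import Data.Nat using (ℕ; _+_; _≤_)
open import Data.Integer using (ℤ; ∣_∣; _-_)
open import Data.List using (List)
open import Data.List.Membership.Propositional using (_∈_)
open import Data.Product using (∃; ∃-syntax; _×_)

open import Data.Nat as ℕ using (zero; suc; _*_; _<_; z≤n)
import Data.Nat.Properties as ℕ
open import Data.Integer as ℤ using (+_; -[1+_]; -_; +<+; +≤+)
import Data.Integer.Properties as ℤ
open import Data.Integer.Tactic.RingSolver using (solve-∀)
open import Data.List using ([]; _∷_)
open import Data.List.Relation.Unary.Any using (here; there)
open import Data.Product using (_,_)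
open import Data.Sum using (_⊎_; inj₁; inj₂)
open import Data.Empty using (⊥-elim)
open import Relation.Nullary using (¬_; yes; no)
open import Relation.Binary.PropositionalEquality
  using (_≡_; refl; sym; cong; subst; module ≡-Reasoning)

Above Below : ℕ → ℤ → Set
Above D x = + D ℤ.< x
Below D x = + D ℤ.< - x

outside-sides : ∀ {D} x → D < ∣ x ∣ → Above D x ⊎ Below D x
outside-sides (+ m)    D<m  = inj₁ (+<+ D<m)
outside-sides -[1+ k ] D<sk = inj₂ (+<+ D<sk)

opposite-sides-far : ∀ {D m k} → D < m → D < suc k →
                     ¬ (∣ + m - -[1+ k ] ∣ ≤ D + D)
opposite-sides-far D<m D<sk = ℕ.<⇒≱ (ℕ.+-mono-< D<m D<sk)

stays-above : ∀ {D x y} → Above D x → ∣ x - y ∣ ≤ D + D → D < ∣ y ∣ → Above D y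
stays-above {x = + m} {y = + m′}     _         _    D<m′ = +<+ D<m′
stays-above {x = + m} {y = -[1+ k ]} (+<+ D<m) step D<sk =
  ⊥-elim (opposite-sides-far D<m D<sk step)

stays-below : ∀ {D x y} → Below D x → ∣ x - y ∣ ≤ D + D → D < ∣ y ∣ → Below D y
stays-below {x = + zero}   (+<+ ())
stays-below {x = -[1+ k ]} {y = -[1+ k′ ]} _          _    D<sk′ = +<+ D<sk′
stays-below {x = -[1+ k ]} {y = + m}       (+<+ D<sk) step D<m   =
  ⊥-elim (opposite-sides-far D<m D<sk
           (subst (_≤ _) (ℤ.∣i-j∣≡∣j-i∣ -[1+ k ] (+ m)) step))

extend : ∀ {P : ℕ → Set} {L} → (∀ i → i ≤ L → P i) → P (suc L) →
         ∀ i → i ≤ suc L → P i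
extend all≤L P[1+L] i i≤1+L with ℕ.m≤n⇒m<n∨m≡n i≤1+L
... | inj₁ i<1+L = all≤L i (ℕ.≤-pred i<1+L)
... | inj₂ refl  = P[1+L]

enters-or-one-sided :
  (f : ℕ → ℤ) (D : ℕ) → (∀ i → ∣ f i - f (suc i) ∣ ≤ D + D) → ∀ L →
  (∃[ i ] ∣ f i ∣ ≤ D) ⊎
  (∀ i → i ≤ L → Above D (f i)) ⊎ (∀ i → i ≤ L → Below D (f i))
enters-or-one-sided f D steps zero with ∣ f 0 ∣ ℕ.≤? D
... | yes inside = inj₁ (0 , inside)
... | no outside with outside-sides (f 0) (ℕ.≰⇒> outside)
...   | inj₁ above = inj₂ (inj₁ λ { i z≤n → above })
...   | inj₂ below = inj₂ (inj₂ λ { i z≤n → below })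
enters-or-one-sided f D steps (suc L) with enters-or-one-sided f D steps L
... | inj₁ found = inj₁ found
... | inj₂ one-sided with ∣ f (suc L) ∣ ℕ.≤? D
...   | yes inside = inj₁ (suc L , inside)
...   | no outside with one-sided
...     | inj₁ above = inj₂ (inj₁ (extend above
            (stays-above (above L ℕ.≤-refl) (steps L) (ℕ.≰⇒> outside))))
...     | inj₂ below = inj₂ (inj₂ (extend below
            (stays-below (below L ℕ.≤-refl) (steps L) (ℕ.≰⇒> outside))))

telescope : (f : ℕ → ℤ) (n K : ℕ) →
            (∀ k → k < K → + 0 ℤ.< f (k * n) - f (k * n + n)) →
            + K ℤ.≤ f 0 - f (K * n)
telescope f n zero    _     = ℤ.≤-reflexive (sym (ℤ.+-inverseʳ (f 0)))
telescope f n (suc K) drops = begin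
  + 1 ℤ.+ + K                                         ≤⟨ ℤ.+-mono-≤ last-drop earlier-drops ⟩
  (f (K * n) - f (K * n + n)) ℤ.+ (f 0 - f (K * n))   ≡⟨ regroup (f 0) (f (K * n)) (f (K * n + n)) ⟩
  f 0 - f (K * n + n)                                 ≡⟨ cong (λ x → f 0 - f x) (ℕ.+-comm (K * n) n) ⟩
  f 0 - f (suc K * n)                                 ∎
  where
  open ℤ.≤-Reasoning
  last-drop : + 1 ℤ.≤ f (K * n) - f (K * n + n)
  last-drop = ℤ.i<j⇒suc[i]≤j (drops K ℕ.≤-refl)
  earlier-drops : + K ℤ.≤ f 0 - f (K * n)
  earlier-drops = telescope f n K (λ k k<K → drops k (ℕ.m<n⇒m<1+n k<K))
  regroup : ∀ a b c → (b - c) ℤ.+ (a - b) ≡ a - c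
  regroup = solve-∀

≤⇒≤∣∣ : ∀ {m x} → + m ℤ.≤ x → m ≤ ∣ x ∣
≤⇒≤∣∣ {x = + k} (+≤+ m≤k) = m≤k

bounded-no-long-descent :
  (f : ℕ → ℤ) (B n : ℕ) → (∀ x → ∣ f x ∣ ≤ B) →
  ¬ (∀ k → k ≤ B + B → + 0 ℤ.< f (k * n) - f (k * n + n))
bounded-no-long-descent f B n bounded drops = ℕ.1+n≰n (begin
  suc (B + B)                ≤⟨ ≤⇒≤∣∣ (telescope f n K (λ k k<K → drops k (ℕ.≤-pred k<K))) ⟩
  ∣ f 0 - f (K * n) ∣        ≤⟨ ℤ.∣i-j∣≤∣i∣+∣j∣ (f 0) (f (K * n)) ⟩
  ∣ f 0 ∣ + ∣ f (K * n) ∣    ≤⟨ ℕ.+-mono-≤ (bounded 0) (bounded (K * n)) ⟩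
  B + B                      ∎)
  where
  open ℕ.≤-Reasoning
  K = suc (B + B)

blockSum-snoc : ∀ ω i n → blockSum ω i (suc n) ≡ blockSum ω i n ℤ.+ ω (i + n)
blockSum-snoc ω i zero    = begin
  ω i ℤ.+ + 0      ≡⟨ ℤ.+-identityʳ (ω i) ⟩
  ω i              ≡⟨ cong ω (sym (ℕ.+-identityʳ i)) ⟩
  ω (i + 0)        ≡⟨ sym (ℤ.+-identityˡ (ω (i + 0))) ⟩
  + 0 ℤ.+ ω (i + 0) ∎
  where open ≡-Reasoning
blockSum-snoc ω i (suc n) = begin
  ω i ℤ.+ blockSum ω (suc i) (suc n)                ≡⟨ cong (λ z → ω i ℤ.+ z) (blockSum-snoc ω (suc i) n) ⟩
  ω i ℤ.+ (blockSum ω (suc i) n ℤ.+ ω (suc i + n))  ≡⟨ sym (ℤ.+-assoc (ω i) _ _) ⟩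
  blockSum ω i (suc n) ℤ.+ ω (suc (i + n))          ≡⟨ cong (λ j → blockSum ω i (suc n) ℤ.+ ω j) (sym (ℕ.+-suc i n)) ⟩
  blockSum ω i (suc n) ℤ.+ ω (i + suc n)            ∎
  where open ≡-Reasoning

blockSum-slide : ∀ ω i n → blockSum ω (suc i) n ≡ blockSum ω i n ℤ.+ ω (i + n) - ω i
blockSum-slide ω i n = begin
  blockSum ω (suc i) n                       ≡⟨ cancel (ω i) (blockSum ω (suc i) n) ⟩
  (ω i ℤ.+ blockSum ω (suc i) n) - ω i       ≡⟨ cong (_- ω i) (blockSum-snoc ω i n) ⟩
  blockSum ω i n ℤ.+ ω (i + n) - ω i         ∎
  where
  open ≡-Reasoning
  cancel : ∀ a b → b ≡ (a ℤ.+ b) - a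
  cancel = solve-∀

blockSum-bound : ∀ {M} ω → (∀ k → ∣ ω k ∣ ≤ M) → ∀ i n → ∣ blockSum ω i n ∣ ≤ n * M
blockSum-bound ω bounded i zero    = z≤n
blockSum-bound ω bounded i (suc n) = ℕ.≤-trans (ℤ.∣i+j∣≤∣i∣+∣j∣ (ω i) _)
  (ℕ.+-mono-≤ (bounded i) (blockSum-bound ω bounded (suc i) n))

-- The balance of the factor UV with U = ω[i, i+n) and V = ω[i+n, i+2n).
balance : (ℕ → ℤ) → ℕ → ℕ → ℤ
balance ω n i = blockSum ω i n - blockSum ω (i + n) n

balance-step : ∀ ω n i → balance ω n i - balance ω n (suc i) ≡
               (ω i - ω (i + n)) - (ω (i + n) - ω (i + n + n))
balance-step ω n i
  rewrite blockSum-slide ω i n | blockSum-slide ω (i + n) n =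
  regroup (blockSum ω i n) (blockSum ω (i + n) n) (ω i) (ω (i + n)) (ω (i + n + n))
  where
  regroup : ∀ x y a b c → (x - y) - ((x ℤ.+ b - a) - (y ℤ.+ c - b)) ≡ (a - b) - (b - c)
  regroup = solve-∀

balance-step-bound : ∀ {M} ω → (∀ k → ∣ ω k ∣ ≤ M) → ∀ n i →
                     ∣ balance ω n i - balance ω n (suc i) ∣ ≤ (M + M) + (M + M)
balance-step-bound {M} ω bounded n i = begin
  ∣ balance ω n i - balance ω n (suc i) ∣                ≡⟨ cong ∣_∣ (balance-step ω n i) ⟩
  ∣ (ω i - ω (i + n)) - (ω (i + n) - ω (i + n + n)) ∣    ≤⟨ ℤ.∣i-j∣≤∣i∣+∣j∣ (ω i - ω (i + n)) (ω (i + n) - ω (i + n + n)) ⟩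
  ∣ ω i - ω (i + n) ∣ + ∣ ω (i + n) - ω (i + n + n) ∣    ≤⟨ ℕ.+-mono-≤ (difference-bound i (i + n)) (difference-bound (i + n) (i + n + n)) ⟩
  (M + M) + (M + M)                                      ∎
  where
  open ℕ.≤-Reasoning
  difference-bound : ∀ j k → ∣ ω j - ω k ∣ ≤ M + M
  difference-bound j k =
    ℕ.≤-trans (ℤ.∣i-j∣≤∣i∣+∣j∣ (ω j) (ω k)) (ℕ.+-mono-≤ (bounded j) (bounded k))

-- On the first 2nM + 1 windows the balance cannot stay positive: the window
-- sums would strictly decrease along the progression 0, n, 2n, …
no-long-positive-run : ∀ {M} ω → (∀ k → ∣ ω k ∣ ≤ M) → ∀ n →
                       ¬ (∀ i → i ≤ (n * M + n * M) * n → + 0 ℤ.< balance ω n i)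
no-long-positive-run {M} ω bounded n positive =
  bounded-no-long-descent (λ x → blockSum ω x n) (n * M) n
    (λ x → blockSum-bound ω bounded x n)
    (λ k k≤2nM → positive (k * n) (ℕ.*-monoˡ-≤ n k≤2nM))

-- Nor can it stay negative: then the negated window sums decrease.
no-long-negative-run : ∀ {M} ω → (∀ k → ∣ ω k ∣ ≤ M) → ∀ n →
                       ¬ (∀ i → i ≤ (n * M + n * M) * n → + 0 ℤ.< - balance ω n i)
no-long-negative-run {M} ω bounded n negative =
  bounded-no-long-descent (λ x → - blockSum ω x n) (n * M) n
    (λ x → subst (_≤ n * M) (sym (ℤ.∣-i∣≡∣i∣ (blockSum ω x n))) (blockSum-bound ω bounded x n))
    (λ k k≤2nM → subst (+ 0 ℤ.<_) (ℤ.neg-distrib-+ (blockSum ω (k * n) n) _)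
                   (negative (k * n) (ℕ.*-monoˡ-≤ n k≤2nM)))

-- Every window length n admits a factor UV with |ΣU − ΣV| ≤ 2M: otherwise the
-- balance would stay on one side of [−2M, 2M] for too long.
balanced-factor : ∀ M ω → (∀ k → ∣ ω k ∣ ≤ M) → ∀ n → ∃[ i ] ∣ balance ω n i ∣ ≤ M + M
balanced-factor M ω bounded n
  with enters-or-one-sided (balance ω n) (M + M) (balance-step-bound ω bounded n)
                           ((n * M + n * M) * n)
... | inj₁ found        = found
... | inj₂ (inj₁ above) = ⊥-elim (no-long-positive-run ω bounded n
                            (λ i i≤L → ℤ.≤-<-trans (+≤+ z≤n) (above i i≤L)))
... | inj₂ (inj₂ below) = ⊥-elim (no-long-negative-run ω bounded n
                            (λ i i≤L → ℤ.≤-<-trans (+≤+ z≤n) (below i i≤L)))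

sumAbs : List ℤ → ℕ
sumAbs []       = 0
sumAbs (x ∷ xs) = ∣ x ∣ + sumAbs xs

∈⇒∣∣≤sumAbs : ∀ {x} S → x ∈ S → ∣ x ∣ ≤ sumAbs S
∈⇒∣∣≤sumAbs (y ∷ ys) (here refl) = ℕ.m≤m+n ∣ y ∣ (sumAbs ys)
∈⇒∣∣≤sumAbs (y ∷ ys) (there x∈ys) =
  ℕ.≤-trans (∈⇒∣∣≤sumAbs ys x∈ys) (ℕ.m≤n+m (sumAbs ys) ∣ y ∣)

-- C = 2 Σ_{s ∈ S} |s|; the factor is found with |U| = |V| = N exactly.
mainTheorem1 : (S : List ℤ) → ∃[ C ] ((ω : ℕ → ℤ) → ((k : ℕ) → ω k ∈ S) →
                 (N : ℕ) → ∃[ i ] ∃[ n ] (N ≤ n ×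
                   ∣ blockSum ω i n - blockSum ω (i + n) n ∣ ≤ C))
mainTheorem1 S = M + M , λ ω letters N →
  let (i , balanced) = balanced-factor M ω (λ k → ∈⇒∣∣≤sumAbs S (letters k)) N
  in  i , N , ℕ.≤-refl , balanced
  where
  M = sumAbs S
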